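{- Consider the variant of the edge-distinguishing game on the path $P_6$ in which the available color set is $[\lambda(P_6)+1]=\{1,2,3,4\}$ instead of $[\lambda(P_6)]$. In this game Player 2 has a winning strategy.
   Context: $P_6$ is the path on 6 vertices; $\lambda(P_6)=3$. For a $k$-coloring $c:V(G)\to\{1,\dots,k\}$ the induced edge coloring is $c'(\{u,v\})=\{c(u),c(v)\}$ (a multiset); $c$ is edge-distinguishing if $c'$ is injective, and $\lambda(G)$ is the least $k$ admitting such a coloring. A partial coloring on $U\subseteq V(G)$ has partial induced edge coloring on $G[U]$. The game with color set $[k]$: two players, Player 1 first, alternately color an uncolored vertex with a color from $[k]$; a move is legal iff afterwards the partial induced edge coloring of the colored vertices is injective. The player making the last legal move wins. A winning strategy guarantees a win regardless of the opponent's play. -}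

module Defs where

open import Data.Nat using (ℕ; suc)
open import Data.Fin using (Fin; toℕ; _≟_)
open import Data.Maybe using (Maybe; just; nothing)
open import Data.Product using (_×_; Σ; _,_)
open import Data.Sum using (_⊎_)
open import Relation.Binary.PropositionalEquality using (_≡_)
open import Relation.Nullary using (yes; no)

PathAdj : (n : ℕ) → Fin n → Fin n → Set
PathAdj n u v = (toℕ v ≡ suc (toℕ u)) ⊎ (toℕ u ≡ suc (toℕ v))

MultiEq : {A : Set} → A → A → A → A → Set
MultiEq a b c d = ((a ≡ c) × (b ≡ d)) ⊎ ((a ≡ d) × (b ≡ c))

-- Partial coloring with colors Fin k: nothing = uncolored.
PartialColoring : ℕ → ℕ → Set
PartialColoring n k = Fin n → Maybe (Fin k)

-- The partial induced edge coloring (defined on edges of G[U], U = colored vertices)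
-- is injective: two edges whose endpoints are all colored and which receive the same
-- multiset of colors are the same edge.
EdgeDistinguishing : {n k : ℕ} → (Fin n → Fin n → Set) → PartialColoring n k → Set
EdgeDistinguishing {n} {k} Adj c =
  (u v u' v' : Fin n) (a b a' b' : Fin k) →
  Adj u v → Adj u' v' →
  c u ≡ just a → c v ≡ just b → c u' ≡ just a' → c v' ≡ just b' →
  MultiEq a b a' b' → MultiEq u v u' v'

colorAt : {n k : ℕ} → PartialColoring n k → Fin n → Fin k → PartialColoring n k
colorAt c v a w with w ≟ v
... | yes _ = just a
... | no _ = c w

Legal : {n k : ℕ} → (Fin n → Fin n → Set) → PartialColoring n k → Fin n → Fin k → Set
Legal Adj c v a = (c v ≡ nothing) × EdgeDistinguishing Adj (colorAt c v a)

-- Normal play (last legal move wins).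
mutual
  data Winning {n k : ℕ} (Adj : Fin n → Fin n → Set) (c : PartialColoring n k) : Set where
    win : (v : Fin n) (a : Fin k) → Legal Adj c v a → Losing Adj (colorAt c v a) → Winning Adj c

  data Losing {n k : ℕ} (Adj : Fin n → Fin n → Set) (c : PartialColoring n k) : Set where
    lose : ((v : Fin n) (a : Fin k) → Legal Adj c v a → Winning Adj (colorAt c v a)) → Losing Adj c

uncolored : {n k : ℕ} → PartialColoring n k
uncolored _ = nothing

Player2Wins : (n k : ℕ) → (Fin n → Fin n → Set) → Set
Player2Wins n k Adj = Losing {n} {k} Adj uncolored

{-# OPTIONS --safe #-}
module Submission where

-- The game tree is finite, so the theorem is proved by reflection: a Boolean minimax search
-- with a move budget evaluates to true on the empty colouring, and its soundness turns that
-- into a winning strategy for Player 2.  Legality of a move is decided by comparing the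
-- colour multisets of every pair of edges of P₆.

open import Defs
open import Data.Bool using (Bool; false; T; _∧_; _∨_)
open import Data.Bool.ListAction using (any; all)
open import Data.Bool.Properties using (T-∧; T-∨)
open import Data.Nat using (ℕ; zero; suc)
open import Data.Nat.Properties using (suc-injective)
open import Data.Fin using (Fin; zero; suc; toℕ; inject₁; _≟_)
open import Data.Fin.Properties using (toℕ-injective; toℕ-inject₁)
open import Data.List using (List; []; _∷_; map; allFin; cartesianProduct)
open import Data.List.Membership.Propositional using (_∈_)
open import Data.List.Membership.Propositional.Properties
  using (∈-map⁺; ∈-map⁻; ∈-allFin; ∈-cartesianProduct⁺; ∈-AllPairs₂)
open import Data.List.Relation.Unary.All as All using ()
open import Data.List.Relation.Unary.All.Properties using (all⁺)
open import Data.List.Relation.Unary.AllPairs using (AllPairs; []; _∷_; allPairs?)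
open import Data.List.Relation.Unary.Any using (here; there; satisfied)
open import Data.List.Relation.Unary.Any.Properties using (any⁻)
open import Data.Maybe using (just; nothing)
open import Data.Maybe.Properties using (≡-dec)
open import Data.Product using (_×_; _,_)
open import Data.Sum using (_⊎_; inj₁; inj₂; [_,_]′)
open import Data.Empty using (⊥-elim)
open import Function using (_∘_)
open import Function.Bundles using (_⇔_; mk⇔; Equivalence)
open import Relation.Binary.Definitions using (DecidableEquality)
open import Relation.Binary.PropositionalEquality using (_≡_; refl; sym; trans; cong; subst)
open import Relation.Nullary using (Dec; yes; no; contradiction)
open import Relation.Nullary.Decidable as Dec
  using (_×-dec_; _⊎-dec_; isYes; isNo; toWitness; toWitnessFalse)

allPairs-tabulate : {A : Set} {R : A → A → Set} {xs : List A} →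
                    (∀ {x y} → x ∈ xs → y ∈ xs → R x y) → AllPairs R xs
allPairs-tabulate {xs = []}     _ = []
allPairs-tabulate {xs = x ∷ xs} r =
  All.tabulate (r (here refl) ∘ there) ∷ allPairs-tabulate (λ i j → r (there i) (there j))

module _ {A : Set} {a b c d : A} where

  MultiEq-sym : MultiEq a b c d → MultiEq c d a b
  MultiEq-sym (inj₁ (p , q)) = inj₁ (sym p , sym q)
  MultiEq-sym (inj₂ (p , q)) = inj₂ (sym q , sym p)

  MultiEq-swapˡ : MultiEq a b c d → MultiEq b a c d
  MultiEq-swapˡ (inj₁ (p , q)) = inj₂ (q , p)
  MultiEq-swapˡ (inj₂ (p , q)) = inj₁ (q , p)

multiEq? : {A : Set} → DecidableEquality A → (a b c d : A) → Dec (MultiEq a b c d)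
multiEq? _≟ᴬ_ a b c d = (a ≟ᴬ c ×-dec b ≟ᴬ d) ⊎-dec (a ≟ᴬ d ×-dec b ≟ᴬ c)

Edge : ℕ → Set
Edge n = Fin n × Fin n

record Enumerates {n : ℕ} (Adj : Fin n → Fin n → Set) (es : List (Edge n)) : Set where
  field
    adjacent : ∀ {u v} → (u , v) ∈ es → Adj u v
    listed   : ∀ {u v} → Adj u v → (u , v) ∈ es ⊎ (v , u) ∈ es

module _ {n k : ℕ} where

  Distinguished : PartialColoring n k → Edge n → Edge n → Set
  Distinguished c (u , v) (u' , v') =
    (a b a' b' : Fin k) →
    c u ≡ just a → c v ≡ just b → c u' ≡ just a' → c v' ≡ just b' →
    MultiEq a b a' b' → MultiEq u v u' v'

  distinguished? : (c : PartialColoring n k) (e e' : Edge n) → Dec (Distinguished c e e')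
  distinguished? c (u , v) (u' , v') with c u | c v | c u' | c v'
  ... | nothing | _ | _ | _ = yes λ { _ _ _ _ () }
  ... | just _ | nothing | _ | _ = yes λ { _ _ _ _ _ () }
  ... | just _ | just _ | nothing | _ = yes λ { _ _ _ _ _ _ () }
  ... | just _ | just _ | just _ | nothing = yes λ { _ _ _ _ _ _ _ () }
  ... | just a | just b | just a' | just b' with multiEq? _≟_ a b a' b' | multiEq? _≟_ u v u' v'
  ...   | no noClash | _ = yes λ { _ _ _ _ refl refl refl refl clash → ⊥-elim (noClash clash) }
  ...   | yes _ | yes same = yes λ _ _ _ _ _ _ _ _ _ → same
  ...   | yes clash | no differ = no λ d → differ (d a b a' b' refl refl refl refl clash)

  module _ {c : PartialColoring n k} where

    Distinguished-refl : ∀ e → Distinguished c e e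
    Distinguished-refl _ _ _ _ _ _ _ _ _ _ = inj₁ (refl , refl)

    Distinguished-sym : ∀ {e e'} → Distinguished c e e' → Distinguished c e' e
    Distinguished-sym d a b a' b' p q p' q' m = MultiEq-sym (d a' b' a b p' q' p q (MultiEq-sym m))

    Distinguished-swapˡ : ∀ {u v e'} → Distinguished c (v , u) e' → Distinguished c (u , v) e'
    Distinguished-swapˡ d a b a' b' p q p' q' m =
      MultiEq-swapˡ (d b a a' b' q p p' q' (MultiEq-swapˡ m))

    Distinguished-swapʳ : ∀ {e u' v'} → Distinguished c e (v' , u') → Distinguished c e (u' , v')
    Distinguished-swapʳ = Distinguished-sym ∘ Distinguished-swapˡ ∘ Distinguished-sym

    distinguished-∈ : ∀ {es e e'} → AllPairs (Distinguished c) es → e ∈ es → e' ∈ es →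
                      Distinguished c e e'
    distinguished-∈ ds i j with ∈-AllPairs₂ ds i j
    ... | inj₁ refl     = Distinguished-refl _
    ... | inj₂ (inj₁ d) = d
    ... | inj₂ (inj₂ d) = Distinguished-sym d

  module _ {Adj : Fin n → Fin n → Set} {es : List (Edge n)} (enum : Enumerates Adj es) where
    open Enumerates enum

    edgeDistinguishing⇔ : (c : PartialColoring n k) →
                          AllPairs (Distinguished c) es ⇔ EdgeDistinguishing Adj c
    edgeDistinguishing⇔ c = mk⇔ fromAllPairs toAllPairs
      where
      fromAllPairs : AllPairs (Distinguished c) es → EdgeDistinguishing Adj c
      fromAllPairs ds u v u' v' a b a' b' uv u'v' with listed uv | listed u'v'
      ... | inj₁ i | inj₁ j = distinguished-∈ ds i j a b a' b'
      ... | inj₂ i | inj₁ j = Distinguished-swapˡ (distinguished-∈ ds i j) a b a' b'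
      ... | inj₁ i | inj₂ j = Distinguished-swapʳ (distinguished-∈ ds i j) a b a' b'
      ... | inj₂ i | inj₂ j =
        Distinguished-swapˡ (Distinguished-swapʳ (distinguished-∈ ds i j)) a b a' b'

      toAllPairs : EdgeDistinguishing Adj c → AllPairs (Distinguished c) es
      toAllPairs ed = allPairs-tabulate λ {(u , v)} {(u' , v')} i j a b a' b' →
        ed u v u' v' a b a' b' (adjacent i) (adjacent j)

    edgeDistinguishing? : (c : PartialColoring n k) → Dec (EdgeDistinguishing Adj c)
    edgeDistinguishing? c = Dec.map (edgeDistinguishing⇔ c) (allPairs? (distinguished? c) es)

    legal? : (c : PartialColoring n k) (v : Fin n) (a : Fin k) → Dec (Legal Adj c v a)
    legal? c v a = ≡-dec _≟_ (c v) nothing ×-dec edgeDistinguishing? (colorAt c v a)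

pathEdges : (n : ℕ) → List (Edge n)
pathEdges zero    = []
pathEdges (suc n) = map (λ i → inject₁ i , suc i) (allFin n)

successor∈pathEdges : ∀ {n} {u v : Fin n} → toℕ v ≡ suc (toℕ u) → (u , v) ∈ pathEdges n
successor∈pathEdges {suc n} {v = suc i} v≡1+u = subst (λ w → (w , suc i) ∈ pathEdges (suc n))
  (toℕ-injective (trans (toℕ-inject₁ i) (suc-injective v≡1+u)))
  (∈-map⁺ (λ i → inject₁ i , suc i) (∈-allFin i))

pathEdges-adjacent : ∀ {n} {u v : Fin n} → (u , v) ∈ pathEdges n → PathAdj n u v
pathEdges-adjacent {suc n} uv with ∈-map⁻ (λ i → inject₁ i , suc i) uv
... | i , _ , refl = inj₁ (cong suc (sym (toℕ-inject₁ i)))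

pathEdges-enumerates : ∀ n → Enumerates (PathAdj n) (pathEdges n)
pathEdges-enumerates n = record
  { adjacent = pathEdges-adjacent
  ; listed   = λ { (inj₁ v≡1+u) → inj₁ (successor∈pathEdges v≡1+u)
                 ; (inj₂ u≡1+v) → inj₂ (successor∈pathEdges u≡1+v) }
  }

module GameSearch {n k : ℕ} {Adj : Fin n → Fin n → Set}
                  (legal? : (c : PartialColoring n k) (v : Fin n) (a : Fin k) → Dec (Legal Adj c v a))
                  where

  moves : List (Fin n × Fin k)
  moves = cartesianProduct (allFin n) (allFin k)

  mutual
    wins : ℕ → PartialColoring n k → Bool
    wins zero       c = false
    wins (suc fuel) c = any (λ (v , a) → isYes (legal? c v a) ∧ loses fuel (colorAt c v a)) moves

    loses : ℕ → PartialColoring n k → Bool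
    loses fuel c = all (λ (v , a) → isNo (legal? c v a) ∨ wins fuel (colorAt c v a)) moves

  mutual
    wins-sound : ∀ fuel c → T (wins fuel c) → Winning Adj c
    wins-sound (suc fuel) c w =
      let (v , a) , move = satisfied (any⁻ _ moves w)
          legal , lost   = Equivalence.to T-∧ move
      in win v a (toWitness {a? = legal? c v a} legal) (loses-sound fuel _ lost)

    loses-sound : ∀ fuel c → T (loses fuel c) → Losing Adj c
    loses-sound fuel c l = lose λ v a legal →
      let answer = All.lookup (all⁺ _ moves l) (∈-cartesianProduct⁺ (∈-allFin v) (∈-allFin a))
      in [ (λ illegal → contradiction legal (toWitnessFalse illegal)) , wins-sound fuel _ ]′
           (Equivalence.to T-∨ answer)

open GameSearch (legal? {k = 4} (pathEdges-enumerates 6))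

-- Fuel is consumed only by Player 2's moves, and Player 2 moves at most three times on six vertices.
theorem3p12 : Player2Wins 6 4 (PathAdj 6)
theorem3p12 = loses-sound 3 uncolored _
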